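{- Let $q$ be a power of $2$ and let $S\subseteq GF(q)^4$ be a vector space over $GF(q)$. If $\mathrm{Matroid}(S)$ is isomorphic to the uniform matroid $U_{2,4}$, then $\mathrm{mult}(S)$ has $\Delta_3$ as a minor.
   Context: $\mathrm{Matroid}(S)$ is the matroid on $[n]$ represented over $GF(q)$ by any matrix $A$ with $S=\{x\in GF(q)^n:Ax=\mathbf{0}\}$; equivalently its circuits are the inclusion-minimal sets among $\{\mathrm{support}(x):x\in S,x\neq\mathbf{0}\}$. A clutter over $V$ is a family of subsets of $V$, no member containing another; for disjoint $I,J\subseteq V$ the minor $\mathcal{C}\setminus I/J$ is the clutter over $V-(I\cup J)$ of inclusion-minimal sets of $\{C-J:C\in\mathcal{C},C\cap I=\emptyset\}$. For a vector space $S\subseteq GF(q)^n$, take $n$ disjoint copies $V_1,\dots,V_n$ of $GF(q)$; $\mathrm{mult}(S)$ is the clutter over $V_1\cup\cdots\cup V_n$ with members $\{x_1,\dots,x_n\}$ ($x_i$ in copy $V_i$) for $(x_1,\dots,x_n)\in S$. $\Delta_3$ is the clutter over $\{1,2,3\}$ with members $\{1,2\},\{2,3\},\{1,3\}$; having it as a minor means some minor is isomorphic to it. -}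

module Defs where

open import Level using (Level; 0ℓ; Lift) renaming (suc to lsuc)
open import Data.Empty using (⊥)
open import Data.Nat using (ℕ; suc; _^_)
open import Data.Fin using (Fin; zero; suc)
open import Data.Fin.Subset using (Subset; inside; outside; ∣_∣; _⊂_)
open import Data.Vec using (tabulate; lookup)
open import Data.Bool using (Bool; true; false; not)
open import Data.Product using (Σ; ∃; ∃-syntax; _×_; _,_; proj₁; proj₂)
open import Data.Sum using (_⊎_)
open import Relation.Nullary using (¬_; Dec; yes; no)
open import Relation.Nullary.Decidable using (⌊_⌋)
open import Relation.Binary.PropositionalEquality using (_≡_; _≢_)
open import Relation.Binary.Definitions using (DecidableEquality)
open import Relation.Unary using (Pred; _⊆_; _∈_)
open import Algebra.Core using (Op₁; Op₂)
open import Algebra.Structures using (IsCommutativeRing)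
open import Function.Bundles using (_↔_; _⇔_; Inverse)

record FiniteField (q : ℕ) : Set₁ where
  infixl 6 _+_
  infixl 7 _*_
  field
    Carrier : Set
    _+_ _*_ : Op₂ Carrier
    -_      : Op₁ Carrier
    0# 1#   : Carrier
    isCommutativeRing : IsCommutativeRing _≡_ _+_ _*_ -_ 0# 1#
    0≢1     : 0# ≢ 1#
    inv     : ∀ x → x ≢ 0# → Σ Carrier λ y → x * y ≡ 1#
    _≟_     : DecidableEquality Carrier
    card    : Carrier ↔ Fin q

-- GF(q) for q a power of 2: any finite field with 2 ^ k elements
-- (finite fields are unique up to isomorphism).

module _ {q : ℕ} (𝔽 : FiniteField q) where
  open FiniteField 𝔽

  Vector : ℕ → Set
  Vector n = Fin n → Carrier

  zeroV : ∀ {n} → Vector n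
  zeroV _ = 0#

  record IsSubspace {n : ℕ} (S : Pred (Vector n) 0ℓ) : Set where
    field
      zero-closed  : zeroV ∈ S
      +-closed     : ∀ {x y} → x ∈ S → y ∈ S → (λ i → x i + y i) ∈ S
      scale-closed : ∀ c {x} → x ∈ S → (λ i → c * x i) ∈ S

  support : ∀ {n} → Vector n → Subset n
  support x = tabulate (λ i → not ⌊ x i ≟ 0# ⌋)

  NonZero : ∀ {n} → Vector n → Set
  NonZero x = x ≢ zeroV

  -- circuits of Matroid(S): inclusion-minimal supports of nonzero vectors of S
  IsCircuitOf : ∀ {n} → Pred (Vector n) 0ℓ → Subset n → Set
  IsCircuitOf S C =
    (Σ (Vector _) λ x → x ∈ S × NonZero x × support x ≡ C)
    × (∀ y → y ∈ S → NonZero y → ¬ (support y ⊂ C))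

IsUniformCircuit : (r n : ℕ) → Subset n → Set
IsUniformCircuit r n C = ∣ C ∣ ≡ suc r

imageSubset : ∀ {n} → Fin n ↔ Fin n → Subset n → Subset n
imageSubset σ C = tabulate (λ j → lookup C (Inverse.from σ j))

MatroidIso : ∀ {n} → (Subset n → Set) → (Subset n → Set) → Set
MatroidIso {n} M N =
  Σ (Fin n ↔ Fin n) λ σ → ∀ C → M C ⇔ N (imageSubset σ C)

Lift′ : Set → Set₁
Lift′ X = Lift (lsuc 0ℓ) X

Clutter : Set → Set₂
Clutter V = Pred V 0ℓ → Set₁

Disjoint : ∀ {V : Set} → Pred V 0ℓ → Pred V 0ℓ → Set
Disjoint I J = ∀ v → I v → J v → ⊥

Remaining : {V : Set} → Pred V 0ℓ → Pred V 0ℓ → Set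
Remaining {V} I J = Σ V λ v → ¬ I v × ¬ J v

-- the family {C - J : C ∈ 𝒞, C ∩ I = ∅}, as sets over V - (I ∪ J)
minorFamily : ∀ {V} → Clutter V → (I J : Pred V 0ℓ) → Pred (Pred (Remaining I J) 0ℓ) (lsuc 0ℓ)
minorFamily {V} 𝒞 I J D =
  Σ (Pred V 0ℓ) λ C → 𝒞 C × (∀ v → C v → ¬ I v)
    × (∀ (w : Remaining I J) → D w ⇔ (C (proj₁ w) × ¬ J (proj₁ w)))

-- 𝒞 \ I / J : inclusion-minimal members of that family
minor : ∀ {V} → Clutter V → (I J : Pred V 0ℓ) → Clutter (Remaining I J)
minor 𝒞 I J D =
  minorFamily 𝒞 I J D × (∀ D′ → minorFamily 𝒞 I J D′ → D′ ⊆ D → D ⊆ D′)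

ClutterIso : ∀ {A B} → Clutter A → Clutter B → Set₁
ClutterIso {A} {B} 𝒜 ℬ =
  Σ (A ↔ B) λ f → ∀ (D : Pred A 0ℓ) → 𝒜 D ⇔ ℬ (λ b → D (Inverse.from f b))

HasMinor : ∀ {V W} → Clutter V → Clutter W → Set₁
HasMinor {V} 𝒞 ℬ =
  Σ (Pred V 0ℓ) λ I → Σ (Pred V 0ℓ) λ J →
    Disjoint I J × ClutterIso (minor 𝒞 I J) ℬ

_≐_ : ∀ {A : Set} → Pred A 0ℓ → Pred A 0ℓ → Set
D ≐ E = D ⊆ E × E ⊆ D

pair : ∀ {A : Set} → A → A → Pred A 0ℓ
pair a b = λ x → x ≡ a ⊎ x ≡ b

-- Δ₃ over {1,2,3} (= Fin 3 : 0,1,2) with members {1,2},{2,3},{1,3}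
Δ₃ : Clutter (Fin 3)
Δ₃ D = Lift′ ((D ≐ pair zero (suc zero)) ⊎ (D ≐ pair (suc zero) (suc (suc zero)))
               ⊎ (D ≐ pair zero (suc (suc zero))))

-- mult(S): ground set V_1 ∪ ... ∪ V_n = Fin n × GF(q);
-- members {x_1,...,x_n} for x ∈ S
mult : ∀ {q} (𝔽 : FiniteField q) {n} → Pred (Vector 𝔽 n) 0ℓ → Clutter (Fin n × FiniteField.Carrier 𝔽)
mult 𝔽 S D = Lift′ (Σ (Vector 𝔽 _) λ x → x ∈ S × (D ≐ λ { (i , a) → x i ≡ a }))

-- Every 3-subset of [4] is a circuit, so a vector of S vanishing at two coordinates is zero: S is
-- a plane, determined by any two coordinates. Take Q, R ∈ S vanishing exactly at coordinates 0
-- and 1 respectively, scaled so that Q₂ = R₂ = t. Delete from mult(S) every element (i , a) whose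
-- value a is not the i-th coordinate of 0, Q or R, and contract every kept element except
-- (0 , 0), (1 , 0) and (2 , t). The vectors of S avoiding the deleted elements are then 0, Q and R
-- (the only other candidate, Q + R, takes a deleted value at coordinate 2 or 3), and their traces
-- on the three remaining elements are the three edges of a triangle.
module Submission where

open import Defs
open import Data.Nat using (ℕ; _^_)
open import Relation.Unary using (Pred)
open import Level using (0ℓ)

open import Level using (lift)
open import Data.Nat using (zero; suc; _∸_)
open import Data.Nat.Properties using (+-0-commutativeMonoid)
open import Data.Bool using (not)
open import Data.Fin using (Fin; zero; suc)
open import Data.Fin.Patterns using (0F; 1F; 2F; 3F)
import Data.Fin.Subset as Sub
open Sub using (Subset; Side; inside; outside; ∣_∣; ⁅_⁆; ∁)
open import Data.Fin.Subset.Properties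
  using (_∈?_; ∣∁p∣≡n∸∣p∣; ∣⁅x⁆∣≡1; x∈⁅x⁆; x∈⁅y⁆⇒x≡y; x∈p⇒x∉∁p; x∉∁p⇒x∈p; x∉p⇒x∈∁p)
open import Data.Vec using (tabulate; lookup)
open import Data.Vec.Properties using ([]=⇒lookup; lookup⇒[]=; lookup∘tabulate; tabulate∘lookup)
open import Data.Product using (Σ; _×_; _,_; proj₁; proj₂)
open import Data.Sum using (_⊎_; inj₁; inj₂; [_,_])
open import Data.Empty using (⊥-elim)
open import Relation.Nullary using (¬_; Dec; yes; no)
open import Relation.Nullary.Decidable using (⌊_⌋; _⊎-dec_; decidable-stable)
open import Relation.Binary.PropositionalEquality
  using (_≡_; _≢_; refl; sym; trans; cong; subst; module ≡-Reasoning)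
open import Relation.Unary using (_∈_; _⊆_)
open import Function using (_∘_; _$_)
open import Function.Bundles using (_↔_; _⇔_; Inverse; Equivalence; mk↔ₛ′; mk⇔)
open import Function.Construct.Symmetry using (↔-sym)
open import Function.Construct.Composition using (_⇔-∘_)
open import Algebra.Core using (Op₂)
open import Algebra.Bundles using (Ring)
open import Algebra.Structures using (IsCommutativeRing)
open import Algebra.Properties.CommutativeMonoid.Sum +-0-commutativeMonoid using (sum; sum-permute)
import Algebra.Properties.Ring as RingProperties
import Algebra.Properties.Group as GroupProperties

sideCount : Side → ℕ
sideCount inside  = 1
sideCount outside = 0

∣tabulate∣≡sum : ∀ {n} (f : Fin n → Side) → ∣ tabulate f ∣ ≡ sum (sideCount ∘ f)
∣tabulate∣≡sum {zero}  f = refl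
∣tabulate∣≡sum {suc n} f with f zero
... | inside  = cong suc (∣tabulate∣≡sum (f ∘ suc))
... | outside = ∣tabulate∣≡sum (f ∘ suc)

∣imageSubset∣ : ∀ {n} (σ : Fin n ↔ Fin n) (C : Subset n) → ∣ imageSubset σ C ∣ ≡ ∣ C ∣
∣imageSubset∣ σ C = begin
  ∣ tabulate (lookup C ∘ Inverse.from σ) ∣        ≡⟨ ∣tabulate∣≡sum (lookup C ∘ Inverse.from σ) ⟩
  sum (sideCount ∘ lookup C ∘ Inverse.from σ)    ≡⟨ sym (sum-permute (sideCount ∘ lookup C) (↔-sym σ)) ⟩
  sum (sideCount ∘ lookup C)                     ≡⟨ sym (∣tabulate∣≡sum (lookup C)) ⟩
  ∣ tabulate (lookup C) ∣                         ≡⟨ cong ∣_∣ (tabulate∘lookup C) ⟩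
  ∣ C ∣                                          ∎
  where open ≡-Reasoning

uniformIso⇒circuit : ∀ {q} (𝔽 : FiniteField q) {r n} {S : Pred (Vector 𝔽 n) 0ℓ} →
  MatroidIso (IsCircuitOf 𝔽 S) (IsUniformCircuit r n) →
  ∀ C → ∣ C ∣ ≡ suc r → IsCircuitOf 𝔽 S C
uniformIso⇒circuit 𝔽 (σ , circuit⇔uniform) C ∣C∣≡ =
  Equivalence.from (circuit⇔uniform C) (trans (∣imageSubset∣ σ C) ∣C∣≡)

module FieldProperties {q : ℕ} (𝔽 : FiniteField q) where
  open FiniteField 𝔽
  open IsCommutativeRing isCommutativeRing using (*-identityʳ; *-assoc; zeroˡ)

  private
    ring : Ring 0ℓ 0ℓ
    ring = record { isRing = IsCommutativeRing.isRing isCommutativeRing }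

  open RingProperties ring using (-1*x≈-x)
  open GroupProperties (Ring.+-group ring) using (x∙y⁻¹≈ε⇒x≈y; x≈y⇒x∙y⁻¹≈ε)
  open GroupProperties (Ring.+-group ring) public using (identityˡ-unique; identityʳ-unique)

  infixl 6 _-_
  _-_ : Op₂ Carrier
  a - b = a + - 1# * b

  a-b≡0⇒a≡b : ∀ a b → a - b ≡ 0# → a ≡ b
  a-b≡0⇒a≡b a b a-b≡0 = x∙y⁻¹≈ε⇒x≈y a b (trans (cong (a +_) (sym (-1*x≈-x b))) a-b≡0)

  a≡b⇒a-b≡0 : ∀ {a b} → a ≡ b → a - b ≡ 0#
  a≡b⇒a-b≡0 {a} {b} a≡b = trans (cong (a +_) (-1*x≈-x b)) (x≈y⇒x∙y⁻¹≈ε a≡b)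

  x*y≡0⇒x≡0 : ∀ {x y} → y ≢ 0# → x * y ≡ 0# → x ≡ 0#
  x*y≡0⇒x≡0 {x} {y} y≢0 x*y≡0 = begin
    x                ≡⟨ sym (*-identityʳ x) ⟩
    x * 1#           ≡⟨ cong (x *_) (sym (proj₂ (inv y y≢0))) ⟩
    x * (y * y⁻¹)    ≡⟨ sym (*-assoc x y y⁻¹) ⟩
    x * y * y⁻¹      ≡⟨ cong (_* y⁻¹) x*y≡0 ⟩
    0# * y⁻¹         ≡⟨ zeroˡ y⁻¹ ⟩
    0#               ∎
    where
    open ≡-Reasoning
    y⁻¹ : Carrier
    y⁻¹ = proj₁ (inv y y≢0)

  *-nonzero : ∀ {x y} → x ≢ 0# → y ≢ 0# → x * y ≢ 0#
  *-nonzero x≢0 y≢0 = x≢0 ∘ x*y≡0⇒x≡0 y≢0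

module Circuits {q : ℕ} (𝔽 : FiniteField q) where
  open FiniteField 𝔽

  lookup-support : ∀ {n} (x : Vector 𝔽 n) i → lookup (support 𝔽 x) i ≡ not ⌊ x i ≟ 0# ⌋
  lookup-support x = lookup∘tabulate (λ i → not ⌊ x i ≟ 0# ⌋)

  ∈support⇒≢0 : ∀ {n} {x : Vector 𝔽 n} {i} → i Sub.∈ support 𝔽 x → x i ≢ 0#
  ∈support⇒≢0 {x = x} {i} i∈ with x i ≟ 0# | trans (sym (lookup-support x i)) ([]=⇒lookup i∈)
  ... | no xᵢ≢0 | _  = xᵢ≢0
  ... | yes _   | ()

  ∉support⇒≡0 : ∀ {n} {x : Vector 𝔽 n} {i} → i Sub.∉ support 𝔽 x → x i ≡ 0#
  ∉support⇒≡0 {x = x} {i} i∉ with x i ≟ 0# | lookup-support x i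
  ... | yes xᵢ≡0 | _         = xᵢ≡0
  ... | no _     | lookupᵢ≡ = ⊥-elim (i∉ (lookup⇒[]= i (support 𝔽 x) lookupᵢ≡))

  vanishing-off⇒support⊆ : ∀ {n} {x : Vector 𝔽 n} {C} →
    (∀ i → i Sub.∉ C → x i ≡ 0#) → support 𝔽 x Sub.⊆ C
  vanishing-off⇒support⊆ {C = C} vanishes {i} i∈ with i ∈? C
  ... | yes i∈C = i∈C
  ... | no  i∉C = ⊥-elim (∈support⇒≢0 i∈ (vanishes i i∉C))

  properly-supported-in-circuit⇒zero : ∀ {n} {S : Pred (Vector 𝔽 n) 0ℓ} {C x j} →
    IsCircuitOf 𝔽 S C → x ∈ S → (∀ i → i Sub.∉ C → x i ≡ 0#) → j Sub.∈ C → x j ≡ 0# →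
    ∀ i → x i ≡ 0#
  properly-supported-in-circuit⇒zero {x = x} {j} (_ , minimal) x∈S vanishes j∈C xⱼ≡0 i
    with x i ≟ 0#
  ... | yes xᵢ≡0 = xᵢ≡0
  ... | no  xᵢ≢0 = ⊥-elim (minimal x x∈S (λ x≡0 → xᵢ≢0 (cong (_$ i) x≡0))
                     (vanishing-off⇒support⊆ vanishes , j , j∈C , λ j∈ → ∈support⇒≢0 j∈ xⱼ≡0))

module UniformCircuits {q : ℕ} (𝔽 : FiniteField q) {m : ℕ} {S : Pred (Vector 𝔽 (suc m)) 0ℓ}
  (S-subspace : IsSubspace 𝔽 S) (circuit : ∀ C → ∣ C ∣ ≡ m → IsCircuitOf 𝔽 S C) where
  open FiniteField 𝔽
  open IsCommutativeRing isCommutativeRing using (zeroʳ)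
  open IsSubspace S-subspace
  open FieldProperties 𝔽
  open Circuits 𝔽

  ∁⁅i⁆-circuit : ∀ i → IsCircuitOf 𝔽 S (∁ ⁅ i ⁆)
  ∁⁅i⁆-circuit i = circuit _ (trans (∣∁p∣≡n∸∣p∣ ⁅ i ⁆) (cong (suc m ∸_) (∣⁅x⁆∣≡1 i)))

  vanishes-at-two⇒zero : ∀ {i j x} → j ≢ i → x ∈ S → x i ≡ 0# → x j ≡ 0# → ∀ l → x l ≡ 0#
  vanishes-at-two⇒zero {i} {j} {x} j≢i x∈S xᵢ≡0 xⱼ≡0 =
    properly-supported-in-circuit⇒zero (∁⁅i⁆-circuit i) x∈S vanishes-off
      (x∉p⇒x∈∁p (j≢i ∘ x∈⁅y⁆⇒x≡y i)) xⱼ≡0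
    where
    vanishes-off : ∀ l → l Sub.∉ ∁ ⁅ i ⁆ → x l ≡ 0#
    vanishes-off l l∉ with x∈⁅y⁆⇒x≡y i (x∉∁p⇒x∈p l∉)
    ... | refl = xᵢ≡0

  agree-at-two⇒≡ : ∀ {i j x y} → j ≢ i → x ∈ S → y ∈ S → x i ≡ y i → x j ≡ y j →
    ∀ l → x l ≡ y l
  agree-at-two⇒≡ j≢i x∈S y∈S xᵢ≡yᵢ xⱼ≡yⱼ l = a-b≡0⇒a≡b _ _
    (vanishes-at-two⇒zero j≢i (+-closed x∈S (scale-closed (- 1#) y∈S))
      (a≡b⇒a-b≡0 xᵢ≡yᵢ) (a≡b⇒a-b≡0 xⱼ≡yⱼ) l)

  record VanishingExactlyAt (i : Fin (suc m)) : Set where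
    field
      vec      : Vector 𝔽 (suc m)
      vec∈S    : vec ∈ S
      vanishes : vec i ≡ 0#
      nonzero  : ∀ {j} → j ≢ i → vec j ≢ 0#

  vanishingExactlyAt : ∀ i → VanishingExactlyAt i
  vanishingExactlyAt i with proj₁ (∁⁅i⁆-circuit i)
  ... | x , x∈S , _ , support≡ = record
    { vec      = x
    ; vec∈S    = x∈S
    ; vanishes = ∉support⇒≡0 {x = x} (subst (i Sub.∉_) (sym support≡) (x∈p⇒x∉∁p (x∈⁅x⁆ i)))
    ; nonzero  = λ {j} j≢i →
        ∈support⇒≢0 {x = x} (subst (j Sub.∈_) (sym support≡) (x∉p⇒x∈∁p (j≢i ∘ x∈⁅y⁆⇒x≡y i)))
    }

  scale : ∀ {i} c → c ≢ 0# → VanishingExactlyAt i → VanishingExactlyAt i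
  scale c c≢0 X = record
    { vec      = λ j → c * vec j
    ; vec∈S    = scale-closed c vec∈S
    ; vanishes = trans (cong (c *_) vanishes) (zeroʳ c)
    ; nonzero  = λ j≢i → *-nonzero c≢0 (nonzero j≢i)
    }
    where open VanishingExactlyAt X

Antichain : ∀ {A : Set} → Clutter A → Set₁
Antichain 𝒜 = ∀ {D D′} → 𝒜 D → 𝒜 D′ → D′ ⊆ D → D ⊆ D′

ClutterIso-antichain : ∀ {A B} {𝒜 : Clutter A} {ℬ : Clutter B} →
  ClutterIso 𝒜 ℬ → Antichain ℬ → Antichain 𝒜
ClutterIso-antichain (e , 𝒜⇔ℬ) antichain {D} {D′} D∈ D′∈ D′⊆D {a} d =
  subst D′ (strictlyInverseʳ a)
    (antichain (to (𝒜⇔ℬ D) D∈) (to (𝒜⇔ℬ D′) D′∈) D′⊆D (subst D (sym (strictlyInverseʳ a)) d))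
  where
  open Inverse e using (strictlyInverseʳ)
  open Equivalence using (to)

minor⇔minorFamily : ∀ {V} {𝒞 : Clutter V} {I J} → Antichain (minorFamily 𝒞 I J) →
  ∀ D → minor 𝒞 I J D ⇔ minorFamily 𝒞 I J D
minor⇔minorFamily antichain D = mk⇔ proj₁ (λ D∈ → D∈ , λ D′ D′∈ → antichain D∈ D′∈)

hasMinor-of-minorFamily : ∀ {V W} {𝒞 : Clutter V} {ℬ : Clutter W} {I J} → Disjoint I J →
  ClutterIso (minorFamily 𝒞 I J) ℬ → Antichain ℬ → HasMinor 𝒞 ℬ
hasMinor-of-minorFamily {I = I} {J} disjoint iso@(e , family⇔ℬ) antichain =
  I , J , disjoint , e ,
  λ D → family⇔ℬ D ⇔-∘ minor⇔minorFamily (ClutterIso-antichain iso antichain) D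

data Edge : Set where
  e01 e02 e12 : Edge

edge : Edge → Pred (Fin 3) 0ℓ
edge e01 = pair 0F 1F
edge e02 = pair 0F 2F
edge e12 = pair 1F 2F

Δ₃⇒edge : ∀ {E} → Δ₃ E → Σ Edge λ k → E ≐ edge k
Δ₃⇒edge (lift (inj₁ E≐))        = e01 , E≐
Δ₃⇒edge (lift (inj₂ (inj₁ E≐))) = e12 , E≐
Δ₃⇒edge (lift (inj₂ (inj₂ E≐))) = e02 , E≐

edge⇒Δ₃ : ∀ {E} k → E ≐ edge k → Δ₃ E
edge⇒Δ₃ e01 E≐ = lift (inj₁ E≐)
edge⇒Δ₃ e12 E≐ = lift (inj₂ (inj₁ E≐))
edge⇒Δ₃ e02 E≐ = lift (inj₂ (inj₂ E≐))

edge⊆edge⇒≡ : ∀ {k k′} → edge k′ ⊆ edge k → k′ ≡ k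
edge⊆edge⇒≡ {e01} {e01} _ = refl
edge⊆edge⇒≡ {e02} {e02} _ = refl
edge⊆edge⇒≡ {e12} {e12} _ = refl
edge⊆edge⇒≡ {e01} {e02} ⊆ = ⊥-elim ([ (λ ()) , (λ ()) ] (⊆ (inj₂ refl)))
edge⊆edge⇒≡ {e01} {e12} ⊆ = ⊥-elim ([ (λ ()) , (λ ()) ] (⊆ (inj₂ refl)))
edge⊆edge⇒≡ {e02} {e01} ⊆ = ⊥-elim ([ (λ ()) , (λ ()) ] (⊆ (inj₂ refl)))
edge⊆edge⇒≡ {e02} {e12} ⊆ = ⊥-elim ([ (λ ()) , (λ ()) ] (⊆ (inj₁ refl)))
edge⊆edge⇒≡ {e12} {e01} ⊆ = ⊥-elim ([ (λ ()) , (λ ()) ] (⊆ (inj₁ refl)))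
edge⊆edge⇒≡ {e12} {e02} ⊆ = ⊥-elim ([ (λ ()) , (λ ()) ] (⊆ (inj₁ refl)))

Δ₃-antichain : Antichain Δ₃
Δ₃-antichain D∈ D′∈ D′⊆D with Δ₃⇒edge D∈ | Δ₃⇒edge D′∈
... | k , D⊆k , _ | k′ , _ , k′⊆D′ with edge⊆edge⇒≡ {k} {k′} (D⊆k ∘ D′⊆D ∘ k′⊆D′)
... | refl = k′⊆D′ ∘ D⊆k

module Δ₃Minor {q : ℕ} (𝔽 : FiniteField q) {S : Pred (Vector 𝔽 4) 0ℓ}
  (S-subspace : IsSubspace 𝔽 S) (circuit : ∀ C → ∣ C ∣ ≡ 3 → IsCircuitOf 𝔽 S C) where
  open FiniteField 𝔽
  open IsCommutativeRing isCommutativeRing using (*-comm; +-identityˡ; +-identityʳ)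
  open IsSubspace S-subspace
  open FieldProperties 𝔽
  open UniformCircuits 𝔽 S-subspace circuit

  module U = VanishingExactlyAt (vanishingExactlyAt 0F)
  module V = VanishingExactlyAt (vanishingExactlyAt 1F)

  Q : VanishingExactlyAt 0F
  Q = scale (V.vec 2F) (V.nonzero (λ ())) (vanishingExactlyAt 0F)
  R : VanishingExactlyAt 1F
  R = scale (U.vec 2F) (U.nonzero (λ ())) (vanishingExactlyAt 1F)

  module Q = VanishingExactlyAt Q
  module R = VanishingExactlyAt R

  t : Carrier
  t = Q.vec 2F

  R₂≡t : R.vec 2F ≡ t
  R₂≡t = *-comm (U.vec 2F) (V.vec 2F)

  Kept : Fin 4 × Carrier → Set
  Kept (0F , a) = a ≡ 0# ⊎ a ≡ R.vec 0F
  Kept (1F , a) = a ≡ 0# ⊎ a ≡ Q.vec 1F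
  Kept (2F , a) = a ≡ 0# ⊎ a ≡ t
  Kept (3F , a) = a ≡ 0# ⊎ a ≡ Q.vec 3F ⊎ a ≡ R.vec 3F

  kept? : ∀ p → Dec (Kept p)
  kept? (0F , a) = a ≟ 0# ⊎-dec a ≟ R.vec 0F
  kept? (1F , a) = a ≟ 0# ⊎-dec a ≟ Q.vec 1F
  kept? (2F , a) = a ≟ 0# ⊎-dec a ≟ t
  kept? (3F , a) = a ≟ 0# ⊎-dec a ≟ Q.vec 3F ⊎-dec a ≟ R.vec 3F

  Deleted : Pred (Fin 4 × Carrier) 0ℓ
  Deleted p = ¬ Kept p

  Contracted : Pred (Fin 4 × Carrier) 0ℓ
  Contracted (0F , a) = a ≡ R.vec 0F
  Contracted (1F , a) = a ≡ Q.vec 1F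
  Contracted (2F , a) = a ≡ 0#
  Contracted (3F , a) = Kept (3F , a)

  ¬deleted⇒kept : ∀ p → ¬ Deleted p → Kept p
  ¬deleted⇒kept p = decidable-stable (kept? p)

  disjoint : Disjoint Deleted Contracted
  disjoint (0F , _) deleted contracted = deleted (inj₂ contracted)
  disjoint (1F , _) deleted contracted = deleted (inj₂ contracted)
  disjoint (2F , _) deleted contracted = deleted (inj₁ contracted)
  disjoint (3F , _) deleted contracted = deleted contracted

  Element : Set
  Element = Remaining Deleted Contracted

  vertex : Fin 3 → Element
  vertex 0F = (0F , 0#) , (λ deleted → deleted (inj₁ refl)) , R.nonzero (λ ()) ∘ sym
  vertex 1F = (1F , 0#) , (λ deleted → deleted (inj₁ refl)) , Q.nonzero (λ ()) ∘ sym
  vertex 2F = (2F , t)  , (λ deleted → deleted (inj₂ refl)) , Q.nonzero (λ ())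

  index : Element → Fin 3
  index ((0F , _) , _) = 0F
  index ((1F , _) , _) = 1F
  index ((2F , _) , _) = 2F
  index ((3F , _) , ¬deleted , ¬contracted) = ⊥-elim (¬deleted ¬contracted)

  -- Proofs of negations are definitionally equal (⊥ has η), so only the value needs matching.
  vertex-index : ∀ w → vertex (index w) ≡ w
  vertex-index ((0F , a) , ¬deleted , ¬contracted) with ¬deleted⇒kept (0F , a) ¬deleted
  ... | inj₁ refl = refl
  ... | inj₂ a≡R₀ = ⊥-elim (¬contracted a≡R₀)
  vertex-index ((1F , a) , ¬deleted , ¬contracted) with ¬deleted⇒kept (1F , a) ¬deleted
  ... | inj₁ refl = refl
  ... | inj₂ a≡Q₁ = ⊥-elim (¬contracted a≡Q₁)
  vertex-index ((2F , a) , ¬deleted , ¬contracted) with ¬deleted⇒kept (2F , a) ¬deleted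
  ... | inj₁ a≡0  = ⊥-elim (¬contracted a≡0)
  ... | inj₂ refl = refl
  vertex-index ((3F , _) , ¬deleted , ¬contracted) = ⊥-elim (¬deleted ¬contracted)

  index-vertex : ∀ b → index (vertex b) ≡ b
  index-vertex 0F = refl
  index-vertex 1F = refl
  index-vertex 2F = refl

  elements : Element ↔ Fin 3
  elements = mk↔ₛ′ index vertex index-vertex vertex-index

  element-elim : (P : Element → Set) → (∀ b → P (vertex b)) → ∀ w → P w
  element-elim P P-vertex w = subst P (vertex-index w) (P-vertex (index w))

  edgeVector : Edge → Vector 𝔽 4
  edgeVector e01 = zeroV 𝔽
  edgeVector e02 = Q.vec
  edgeVector e12 = R.vec

  edgeVector∈S : ∀ k → edgeVector k ∈ S
  edgeVector∈S e01 = zero-closed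
  edgeVector∈S e02 = Q.vec∈S
  edgeVector∈S e12 = R.vec∈S

  edgeVector-kept : ∀ k i → Kept (i , edgeVector k i)
  edgeVector-kept e01 0F = inj₁ refl
  edgeVector-kept e01 1F = inj₁ refl
  edgeVector-kept e01 2F = inj₁ refl
  edgeVector-kept e01 3F = inj₁ refl
  edgeVector-kept e02 0F = inj₁ Q.vanishes
  edgeVector-kept e02 1F = inj₂ refl
  edgeVector-kept e02 2F = inj₂ refl
  edgeVector-kept e02 3F = inj₂ (inj₁ refl)
  edgeVector-kept e12 0F = inj₂ refl
  edgeVector-kept e12 1F = inj₁ R.vanishes
  edgeVector-kept e12 2F = inj₂ R₂≡t
  edgeVector-kept e12 3F = inj₂ (inj₂ refl)

  Hits : Vector 𝔽 4 → Element → Set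
  Hits x ((i , a) , _) = x i ≡ a

  hits⇒edge : ∀ k b → Hits (edgeVector k) (vertex b) → edge k b
  hits⇒edge e01 0F _ = inj₁ refl
  hits⇒edge e01 1F _ = inj₂ refl
  hits⇒edge e01 2F 0≡t = ⊥-elim (Q.nonzero (λ ()) (sym 0≡t))
  hits⇒edge e02 0F _ = inj₁ refl
  hits⇒edge e02 1F Q₁≡0 = ⊥-elim (Q.nonzero (λ ()) Q₁≡0)
  hits⇒edge e02 2F _ = inj₂ refl
  hits⇒edge e12 0F R₀≡0 = ⊥-elim (R.nonzero (λ ()) R₀≡0)
  hits⇒edge e12 1F _ = inj₁ refl
  hits⇒edge e12 2F _ = inj₂ refl

  edge⇒hits : ∀ k b → edge k b → Hits (edgeVector k) (vertex b)
  edge⇒hits e01 _ (inj₁ refl) = refl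
  edge⇒hits e01 _ (inj₂ refl) = refl
  edge⇒hits e02 _ (inj₁ refl) = Q.vanishes
  edge⇒hits e02 _ (inj₂ refl) = refl
  edge⇒hits e12 _ (inj₁ refl) = R.vanishes
  edge⇒hits e12 _ (inj₂ refl) = R₂≡t

  Q+R : Vector 𝔽 4
  Q+R i = Q.vec i + R.vec i

  Q+R∈S : Q+R ∈ S
  Q+R∈S = +-closed Q.vec∈S R.vec∈S

  Q+R₀≡R₀ : Q+R 0F ≡ R.vec 0F
  Q+R₀≡R₀ = trans (cong (_+ R.vec 0F) Q.vanishes) (+-identityˡ _)

  Q+R₁≡Q₁ : Q+R 1F ≡ Q.vec 1F
  Q+R₁≡Q₁ = trans (cong (Q.vec 1F +_) R.vanishes) (+-identityʳ _)

  Q+R-not-kept : ¬ (∀ i → Kept (i , Q+R i))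
  Q+R-not-kept kept with kept 2F | kept 3F
  ... | inj₂ Q₂+R₂≡Q₂ | _                      = R.nonzero (λ ()) (identityʳ-unique _ _ Q₂+R₂≡Q₂)
  ... | inj₁ _        | inj₂ (inj₁ Q₃+R₃≡Q₃) = R.nonzero (λ ()) (identityʳ-unique _ _ Q₃+R₃≡Q₃)
  ... | inj₁ _        | inj₂ (inj₂ Q₃+R₃≡R₃) = Q.nonzero (λ ()) (identityˡ-unique _ _ Q₃+R₃≡R₃)
  ... | inj₁ Q₂+R₂≡0  | inj₁ Q₃+R₃≡0         = R.nonzero (λ ())
    (trans (sym Q+R₀≡R₀) (vanishes-at-two⇒zero (λ ()) Q+R∈S Q₂+R₂≡0 Q₃+R₃≡0 0F))

  kept-vector⇒edgeVector : ∀ {x} → x ∈ S → (∀ i → Kept (i , x i)) →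
    Σ Edge λ k → ∀ i → x i ≡ edgeVector k i
  kept-vector⇒edgeVector {x} x∈S kept with kept 0F | kept 1F
  ... | inj₁ x₀≡0 | inj₁ x₁≡0 = e01 , agree-at-two⇒≡ (λ ()) x∈S zero-closed x₀≡0 x₁≡0
  ... | inj₁ x₀≡0 | inj₂ x₁≡Q₁ =
    e02 , agree-at-two⇒≡ (λ ()) x∈S Q.vec∈S (trans x₀≡0 (sym Q.vanishes)) x₁≡Q₁
  ... | inj₂ x₀≡R₀ | inj₁ x₁≡0 =
    e12 , agree-at-two⇒≡ (λ ()) x∈S R.vec∈S x₀≡R₀ (trans x₁≡0 (sym R.vanishes))
  ... | inj₂ x₀≡R₀ | inj₂ x₁≡Q₁ =
    ⊥-elim (Q+R-not-kept λ i → subst (λ a → Kept (i , a)) (x≡Q+R i) (kept i))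
    where
    x≡Q+R : ∀ i → x i ≡ Q+R i
    x≡Q+R = agree-at-two⇒≡ (λ ()) x∈S Q+R∈S (trans x₀≡R₀ (sym Q+R₀≡R₀)) (trans x₁≡Q₁ (sym Q+R₁≡Q₁))

  minorFamily≅Δ₃ : ClutterIso (minorFamily (mult 𝔽 S) Deleted Contracted) Δ₃
  minorFamily≅Δ₃ = elements , λ D → mk⇔ (family⇒Δ₃ D) (Δ₃⇒family D)
    where
    family⇒Δ₃ : ∀ D → minorFamily (mult 𝔽 S) Deleted Contracted D → Δ₃ (D ∘ vertex)
    family⇒Δ₃ D (C , lift (x , x∈S , C⊆graph , graph⊆C) , avoids , D⇔) =
      edge⇒Δ₃ k ((λ {b} → D⇒edge b) , λ {b} → edge⇒D b)
      where
      open Equivalence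
      classified : Σ Edge λ k → ∀ i → x i ≡ edgeVector k i
      classified = kept-vector⇒edgeVector x∈S λ i →
        ¬deleted⇒kept (i , x i) (avoids (i , x i) (graph⊆C refl))
      k : Edge
      k = proj₁ classified
      x≡k : ∀ i → x i ≡ edgeVector k i
      x≡k = proj₂ classified
      D⇒edge : ∀ b → D (vertex b) → edge k b
      D⇒edge b d = hits⇒edge k b (trans (sym (x≡k _)) (C⊆graph (proj₁ (to (D⇔ (vertex b)) d))))
      edge⇒D : ∀ b → edge k b → D (vertex b)
      edge⇒D b e = from (D⇔ (vertex b))
        (graph⊆C (trans (x≡k _) (edge⇒hits k b e)) , proj₂ (proj₂ (vertex b)))

    Δ₃⇒family : ∀ D → Δ₃ (D ∘ vertex) → minorFamily (mult 𝔽 S) Deleted Contracted D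
    Δ₃⇒family D D∈Δ₃ with Δ₃⇒edge D∈Δ₃
    ... | k , D⊆k , k⊆D =
        (λ (i , a) → x i ≡ a)
      , lift (x , edgeVector∈S k , (λ xᵢ≡a → xᵢ≡a) , (λ xᵢ≡a → xᵢ≡a))
      , (λ (i , a) xᵢ≡a deleted → deleted (subst (λ a → Kept (i , a)) xᵢ≡a (edgeVector-kept k i)))
      , λ w → mk⇔ (λ d → D⇒hits w d , proj₂ (proj₂ w)) (hits⇒D w ∘ proj₁)
      where
      x : Vector 𝔽 4
      x = edgeVector k
      D⇒hits : ∀ w → D w → Hits x w
      D⇒hits = element-elim (λ w → D w → Hits x w) λ b → edge⇒hits k b ∘ D⊆k
      hits⇒D : ∀ w → Hits x w → D w
      hits⇒D = element-elim (λ w → Hits x w → D w) λ b → k⊆D ∘ hits⇒edge k b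

  hasΔ₃Minor : HasMinor (mult 𝔽 S) Δ₃
  hasΔ₃Minor = hasMinor-of-minorFamily disjoint minorFamily≅Δ₃ Δ₃-antichain

lemma5p1 : (k : ℕ) (𝔽 : FiniteField (2 ^ k)) (S : Pred (Vector 𝔽 4) 0ℓ) →
    IsSubspace 𝔽 S →
    MatroidIso (IsCircuitOf 𝔽 S) (IsUniformCircuit 2 4) →
    HasMinor (mult 𝔽 S) Δ₃
lemma5p1 k 𝔽 S S-subspace matroid≅U₂₄ =
  Δ₃Minor.hasΔ₃Minor 𝔽 S-subspace (uniformIso⇒circuit 𝔽 matroid≅U₂₄)
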